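{- Let $G=(V,E)$ be a graph and $U\subset V$ with $|U|=7$ such that the cut $\delta(U)$ has exactly three elements, $\delta(U)=\{e_1,e_2,e_3\}$, and let $v_1,v_2,v_3\in U$ be the end vertices in $U$ of $e_1,e_2,e_3$ respectively. Suppose that $G[U]$ contains a cycle $C$ of length at most $8$ which visits every vertex of $U$, and that for every pair of vertices $v,w\in\{v_1,v_2,v_3\}$ there exists a path $P(v,w)$ in $G[U]$ of length at most $7$ from $v$ to $w$ which visits every vertex of $U$. Let $H$ be the graph obtained from $G$ by replacing $G[U]$ by a triangle (with $e_1,e_2,e_3$ attached to its three distinct vertices), and let $T'$ be a TSP tour in $H$. Then there exists a TSP tour $T$ in $G$ with $|T|\leq |T'|+5$.
   Context: A TSP tour of a graph is a connected spanning multi-subgraph in which every vertex has even degree and each edge is used at most twice; $|T|$ is its number of edges counted with multiplicity. -}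

module Defs where

open import Data.Nat using (ℕ; zero; suc; _+_; _≤_)
open import Data.Nat.Divisibility using (_∣_)
open import Data.Fin using (Fin; zero; suc)
import Data.Fin.Properties as FinP
open import Data.Fin.Subset using (Subset; inside; outside)
open import Data.Bool using (Bool)
import Data.Bool.Properties as BoolP
open import Data.Vec using (lookup)
open import Data.List using (List; []; _∷_; length; filter; map)
open import Data.Nat.ListAction using (sum)
open import Data.List.Membership.Propositional using (_∈_)
open import Data.List.Relation.Unary.All using (All)
open import Data.Product using (Σ; Σ-syntax; _×_; _,_; proj₁; proj₂)
open import Data.Sum using (_⊎_; inj₁; inj₂)
open import Relation.Binary.PropositionalEquality using (_≡_; refl; cong; cong₂)
open import Relation.Binary.Definitions using (DecidableEquality)
open import Relation.Nullary using (yes; no; Dec)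
open import Relation.Nullary.Decidable using (map′)
import Axiom.UniquenessOfIdentityProofs as UIP

-- (Multi)graphs: a vertex type, an edge type (both with decidable
-- equality) and an endpoint map.  Edges are undirected: the order of
-- the pair returned by 'ends' is irrelevant everywhere below.

record Graph : Set₁ where
  field
    V    : Set
    E    : Set
    _≟V_ : DecidableEquality V
    _≟E_ : DecidableEquality E
    ends : E → V × V

module _ (G : Graph) where
  open Graph G

  Joins : E → V → V → Set
  Joins e u w = (ends e ≡ (u , w)) ⊎ (ends e ≡ (w , u))

  data Walk : V → V → Set where
    []   : ∀ {u} → Walk u u
    step : ∀ {u w x} (e : E) → Joins e u w → Walk w x → Walk u x

  walkEdges : ∀ {u w} → Walk u w → List E
  walkEdges []             = []
  walkEdges (step e _ p)   = e ∷ walkEdges p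

  walkVertices : ∀ {u w} → Walk u w → List V
  walkVertices {u} []           = u ∷ []
  walkVertices {u} (step e _ p) = u ∷ walkVertices p

  walkLength : ∀ {u w} → Walk u w → ℕ
  walkLength p = length (walkEdges p)

  Spanning : ∀ {u w} → Walk u w → Set
  Spanning p = ∀ (v : V) → v ∈ walkVertices p

  -- A multi-subgraph is given by the list of its edges (with repetition);
  -- multiplicity of e in T
  mult : List E → E → ℕ
  mult T e = length (filter (λ f → e ≟E f) T)

  -- number of endpoints of e equal to v (a loop counts twice)
  incidence : V → E → ℕ
  incidence v e = ind (v ≟V proj₁ (ends e)) + ind (v ≟V proj₂ (ends e))
    where
      ind : ∀ {P : Set} → Dec P → ℕ
      ind (yes _) = 1
      ind (no _)  = 0

  degree : List E → V → ℕ
  degree T v = sum (map (incidence v) T)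

  -- TSP tour: connected spanning multi-subgraph, every vertex of even
  -- degree, every edge used at most twice.  |T| = length T.
  record IsTSPTour (T : List E) : Set where
    field
      atMostTwice : ∀ e → mult T e ≤ 2
      evenDegree  : ∀ v → 2 ∣ degree T v
      connected   : ∀ u w → Σ[ p ∈ Walk u w ] All (_∈ T) (walkEdges p)

finGraph : (n m : ℕ) → (Fin m → Fin n × Fin n) → Graph
finGraph n m ends = record
  { V = Fin n ; E = Fin m ; _≟V_ = FinP._≟_ ; _≟E_ = FinP._≟_ ; ends = ends }

InU OutU : ∀ {n} → Subset n → Fin n → Set
InU  U v = lookup U v ≡ inside
OutU U v = lookup U v ≡ outside

bool-irr : ∀ {a b : Bool} (p q : a ≡ b) → p ≡ q
bool-irr = UIP.Decidable⇒UIP.≡-irrelevant BoolP._≟_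

module _ {k : ℕ} (P : Fin k → Set) (irr : ∀ {i} (p q : P i) → p ≡ q) where
  Σ-dec : DecidableEquality (Σ (Fin k) P)
  Σ-dec (i , p) (j , q) with FinP._≟_ i j
  ... | yes refl = yes (cong (i ,_) (irr p q))
  ... | no i≢j  = no (λ eq → i≢j (cong proj₁ eq))

⊎-dec : ∀ {A B : Set} → DecidableEquality A → DecidableEquality B → DecidableEquality (A ⊎ B)
⊎-dec dA dB (inj₁ a) (inj₁ a') = map′ (cong inj₁) (λ { refl → refl }) (dA a a')
⊎-dec dA dB (inj₁ a) (inj₂ b') = no (λ ())
⊎-dec dA dB (inj₂ b) (inj₁ a') = no (λ ())
⊎-dec dA dB (inj₂ b) (inj₂ b') = map′ (cong inj₂) (λ { refl → refl }) (dB b b')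

module _ {n m : ℕ} (ends : Fin m → Fin n × Fin n) (U : Subset n) where

  InCut : Fin m → Set
  InCut f = (InU U (proj₁ (ends f)) × OutU U (proj₂ (ends f)))
          ⊎ (OutU U (proj₁ (ends f)) × InU U (proj₂ (ends f)))

  InsideEdge OutsideEdge : Fin m → Set
  InsideEdge  f = InU U (proj₁ (ends f)) × InU U (proj₂ (ends f))
  OutsideEdge f = OutU U (proj₁ (ends f)) × OutU U (proj₂ (ends f))

  pair-irr : ∀ {A B : Set} (irA : (p q : A) → p ≡ q) (irB : (p q : B) → p ≡ q)
             (p q : A × B) → p ≡ q
  pair-irr irA irB (a , b) (a' , b') = cong₂ _,_ (irA a a') (irB b b')

  induced : Graph
  induced = record
    { V    = Σ (Fin n) (InU U)
    ; E    = Σ (Fin m) InsideEdge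
    ; _≟V_ = Σ-dec (InU U) bool-irr
    ; _≟E_ = Σ-dec InsideEdge (pair-irr bool-irr bool-irr)
    ; ends = λ { (f , p , q) → ((proj₁ (ends f) , p) , (proj₂ (ends f) , q)) }
    }

  -- The graph H obtained from G by replacing G[U] by a triangle on new
  -- vertices 0,1,2 : Fin 3, the cut edge e i (whose end outside U is x i)
  -- being re-attached to the triangle vertex i.
  -- Edges of H: the edges of G with both ends outside U, the three
  -- re-attached cut edges, and the three triangle edges.
  triangleEnds : Fin 3 → Fin 3 × Fin 3
  triangleEnds zero             = (zero , suc zero)
  triangleEnds (suc zero)       = (suc zero , suc (suc zero))
  triangleEnds (suc (suc zero)) = (suc (suc zero) , zero)

  contract : (x : Fin 3 → Fin n) → (∀ i → OutU U (x i)) → Graph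
  contract x xout = record
    { V    = Σ (Fin n) (OutU U) ⊎ Fin 3
    ; E    = Σ (Fin m) OutsideEdge ⊎ (Fin 3 ⊎ Fin 3)
    ; _≟V_ = ⊎-dec (Σ-dec (OutU U) bool-irr) FinP._≟_
    ; _≟E_ = ⊎-dec (Σ-dec OutsideEdge (pair-irr bool-irr bool-irr))
                   (⊎-dec FinP._≟_ FinP._≟_)
    ; ends = endsH
    }
    where
      endsH : Σ (Fin m) OutsideEdge ⊎ (Fin 3 ⊎ Fin 3)
            → (Σ (Fin n) (OutU U) ⊎ Fin 3) × (Σ (Fin n) (OutU U) ⊎ Fin 3)
      endsH (inj₁ (f , p , q))  = (inj₁ (proj₁ (ends f) , p) , inj₁ (proj₂ (ends f) , q))
      endsH (inj₂ (inj₁ i))     = (inj₁ (x i , xout i) , inj₂ i)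
      endsH (inj₂ (inj₂ t))     = (inj₂ (proj₁ (triangleEnds t)) , inj₂ (proj₂ (triangleEnds t)))

module Submission where

open import Defs hiding (⊎-dec)
open import Data.Bool using (Bool; true; false; if_then_else_; _∧_; _∨_)
open import Data.Empty using (⊥-elim)
open import Data.Fin using (Fin)
open import Data.Fin.Patterns using (0F; 1F; 2F)
import Data.Fin.Properties as FinP
open import Data.Fin.Subset using (Subset; ∣_∣)
open import Data.List using (List; []; _∷_; _++_; length; map; replicate; concatMap; allFin)
open import Data.List.Properties using (map-++; map-cong; filter-some; length-++; length-replicate)
open import Data.List.Membership.Propositional using (_∈_)
open import Data.List.Membership.Propositional.Properties using (∈-concatMap⁺; ∈-allFin)
open import Data.List.Relation.Binary.Subset.Propositional using (_⊆_)
open import Data.List.Relation.Binary.Subset.Propositional.Properties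
  using (∷⁺ʳ; ∈-∷⁺ʳ; xs⊆xs++ys; xs⊆ys++xs; ⊆-trans)
open import Data.List.Relation.Unary.All as All using (All; []; _∷_)
open import Data.List.Relation.Unary.Any as Any using (here; there)
open import Data.Nat using (ℕ; zero; suc; _+_; _*_; _≤_; _<_; _%_; _≡ᵇ_; _≤ᵇ_; z≤n; s≤s)
open import Data.Nat.Divisibility using (_∣_; _∣?_; divides; ∣m∣n⇒∣m+n; ∣m+n∣m⇒∣n; ∣m⇒∣m*n)
open import Data.Nat.ListAction using (sum)
open import Data.Nat.ListAction.Properties using (sum-++)
open import Data.Nat.Properties
open import Algebra.Properties.CommutativeSemigroup +-commutativeSemigroup using (interchange; x∙yz≈y∙xz; x∙yz≈yx∙z)
open import Data.Nat.Tactic.RingSolver using (solve-∀)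
open import Data.Product using (Σ-syntax; ∃-syntax; _×_; _,_; proj₁; proj₂)
open import Data.Sum using (_⊎_; inj₁; inj₂)
open import Data.Vec using (lookup)
import Data.Vec.Functional as Vector
open import Function using (_∘_)
open import Relation.Binary.Definitions using (DecidableEquality)
open import Relation.Binary.PropositionalEquality
open import Relation.Nullary using (Dec; yes; no; does; ¬_)
open import Relation.Nullary.Decidable using (_×-dec_; _⊎-dec_; _→-dec_; toWitness)
open import Relation.Unary using (Decidable)

-- Write a l and t s for the multiplicities in T' of the cut edge at corner l
-- and of side s of the triangle.  T keeps the edges of T' outside U, takes
-- c l copies of e l with c l ≡ a l (mod 2), and replaces the triangle by one
-- spanning walk of G[U]: the closed walk C when every a l is even, otherwise
-- the path P(v i, v j) between the two corners with a i, a j odd.  Parities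
-- outside U are those of T', and inside U the odd c l sit exactly at the ends
-- of the walk.  A corner with a l = 2 that meets no side of the triangle may
-- be cut off (c l = 0): whatever hangs from it is reached through another
-- corner.  With these choices |T| ≤ |T'| + 5 is a check over the finitely
-- many values a l, t s ∈ {0, 1, 2}; surplus copies of edges are then removed
-- in pairs.

kronecker : {A : Set} → DecidableEquality A → A → A → ℕ
kronecker _≟_ a b = if does (a ≟ b) then 1 else 0

2∣n+n : ∀ n → 2 ∣ n + n
2∣n+n n = divides n (double n)
  where
    double : ∀ d → d + d ≡ d * 2
    double = solve-∀

sum-map-+ : {A : Set} (f g : A → ℕ) (L : List A) → sum (map (λ a → f a + g a) L) ≡ sum (map f L) + sum (map g L)
sum-map-+ f g []      = refl
sum-map-+ f g (a ∷ L) = trans (cong (f a + g a +_) (sum-map-+ f g L)) (interchange (f a) (g a) _ _)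

length-concatMap : {A B : Set} (h : A → List B) (L : List A) →
                   length (concatMap h L) ≡ sum (map (λ a → length (h a)) L)
length-concatMap h []      = refl
length-concatMap h (a ∷ L) = trans (length-++ (h a)) (cong (length (h a) +_) (length-concatMap h L))

∈-replicate : ∀ {A : Set} {k} (a : A) → 1 ≤ k → a ∈ replicate k a
∈-replicate a (s≤s _) = here refl

δ₃ : Fin 3 → Fin 3 → ℕ
δ₃ = kronecker FinP._≟_

Σ₃ : (Fin 3 → ℕ) → ℕ
Σ₃ f = sum (map f (allFin 3))

Σ₃-cong : {f g : Fin 3 → ℕ} → (∀ l → f l ≡ g l) → Σ₃ f ≡ Σ₃ g
Σ₃-cong f≗g = cong sum (map-cong f≗g (allFin 3))

Σ₃-δ₃ : ∀ l → Σ₃ (λ l' → δ₃ l' l) ≡ 1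
Σ₃-δ₃ 0F = refl
Σ₃-δ₃ 1F = refl
Σ₃-δ₃ 2F = refl

Σ₃-bump : ∀ l {k k' : Fin 3 → ℕ} → (∀ l' → k' l' ≡ δ₃ l' l + k l') → Σ₃ k' ≡ suc (Σ₃ k)
Σ₃-bump l {k} k'≗ = trans (Σ₃-cong k'≗) (trans (sum-map-+ (λ l' → δ₃ l' l) k (allFin 3)) (cong (_+ Σ₃ k) (Σ₃-δ₃ l)))

Σ₃-select : ∀ l (d : Fin 3 → ℕ) → Σ₃ (λ l' → δ₃ l' l * d l') ≡ d l
Σ₃-select 0F d = trans (+-identityʳ _) (+-identityʳ _)
Σ₃-select 1F d = trans (+-identityʳ _) (+-identityʳ _)
Σ₃-select 2F d = trans (+-identityʳ _) (+-identityʳ _)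

Σ₃-select₂ : ∀ i j (d : Fin 3 → ℕ) → Σ₃ (λ l → (δ₃ l i + δ₃ l j) * d l) ≡ d i + d j
Σ₃-select₂ i j d = begin
  Σ₃ (λ l → (δ₃ l i + δ₃ l j) * d l)
    ≡⟨ Σ₃-cong (λ l → *-distribʳ-+ (d l) (δ₃ l i) (δ₃ l j)) ⟩
  Σ₃ (λ l → δ₃ l i * d l + δ₃ l j * d l)
    ≡⟨ sum-map-+ (λ l → δ₃ l i * d l) (λ l → δ₃ l j * d l) (allFin 3) ⟩
  Σ₃ (λ l → δ₃ l i * d l) + Σ₃ (λ l → δ₃ l j * d l)
    ≡⟨ cong₂ _+_ (Σ₃-select i d) (Σ₃-select j d) ⟩
  d i + d j ∎
  where open ≡-Reasoning

Σ₃-parity : ∀ D {p q : Fin 3 → ℕ} (X : Fin 3 → ℕ) → (∀ l → 2 ∣ p l + q l) →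
            2 ∣ D + Σ₃ (λ l → p l * X l) → 2 ∣ D + Σ₃ (λ l → q l * X l)
Σ₃-parity D {p} {q} X p≡q even-p = ∣m+n∣m⇒∣n even-both even-p
  where
    even-sum : 2 ∣ Σ₃ (λ l → (p l + q l) * X l)
    even-sum = ∣m∣n⇒∣m+n (term 0F) (∣m∣n⇒∣m+n (term 1F) (∣m∣n⇒∣m+n (term 2F) (divides 0 refl)))
      where
        term : ∀ l → 2 ∣ (p l + q l) * X l
        term l = ∣m⇒∣m*n (X l) (p≡q l)
    split : D * 2 + Σ₃ (λ l → (p l + q l) * X l) ≡ (D + Σ₃ (λ l → p l * X l)) + (D + Σ₃ (λ l → q l * X l))
    split = begin
      D * 2 + Σ₃ (λ l → (p l + q l) * X l)
        ≡⟨ cong (D * 2 +_) (Σ₃-cong (λ l → *-distribʳ-+ (X l) (p l) (q l))) ⟩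
      D * 2 + Σ₃ (λ l → p l * X l + q l * X l)
        ≡⟨ cong (D * 2 +_) (sum-map-+ (λ l → p l * X l) (λ l → q l * X l) (allFin 3)) ⟩
      D * 2 + (Σ₃ (λ l → p l * X l) + Σ₃ (λ l → q l * X l))
        ≡⟨ distribute D _ _ ⟩
      (D + Σ₃ (λ l → p l * X l)) + (D + Σ₃ (λ l → q l * X l)) ∎
      where
        open ≡-Reasoning
        distribute : ∀ d a b → d * 2 + (a + b) ≡ (d + a) + (d + b)
        distribute = solve-∀
    even-both : 2 ∣ (D + Σ₃ (λ l → p l * X l)) + (D + Σ₃ (λ l → q l * X l))
    even-both = subst (2 ∣_) split (∣m∣n⇒∣m+n (divides D refl) even-sum)

-- Multi-subgraphs of an arbitrary graph

module _ (G : Graph) where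
  open Graph G

  δ : V → V → ℕ
  δ = kronecker _≟V_

  incidence-δ : ∀ v f → incidence G v f ≡ δ v (proj₁ (ends f)) + δ v (proj₂ (ends f))
  incidence-δ v f with v ≟V proj₁ (ends f) | v ≟V proj₂ (ends f)
  ... | yes _ | yes _ = refl
  ... | yes _ | no  _ = refl
  ... | no  _ | yes _ = refl
  ... | no  _ | no  _ = refl

  Joins-sym : ∀ {f u w} → Joins G f u w → Joins G f w u
  Joins-sym (inj₁ eq) = inj₂ eq
  Joins-sym (inj₂ eq) = inj₁ eq

  incidence-Joins : ∀ {f u w} → Joins G f u w → ∀ v → incidence G v f ≡ δ v u + δ v w
  incidence-Joins {f} (inj₁ eq) v rewrite incidence-δ v f | eq = refl
  incidence-Joins {f} (inj₂ eq) v rewrite incidence-δ v f | eq = +-comm (δ v _) _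

  δ-refl : ∀ v → δ v v ≡ 1
  δ-refl v with v ≟V v
  ... | yes _  = refl
  ... | no v≢v = ⊥-elim (v≢v refl)

  incidence-Joins-pos : ∀ {f u w} → Joins G f u w → 1 ≤ incidence G u f
  incidence-Joins-pos {u = u} j rewrite incidence-Joins j u | δ-refl u = s≤s z≤n

  degree-++ : ∀ A B v → degree G (A ++ B) v ≡ degree G A v + degree G B v
  degree-++ A B v rewrite map-++ (incidence G v) A B = sum-++ (map (incidence G v) A) _

  degree-replicate : ∀ k f v → degree G (replicate k f) v ≡ k * incidence G v f
  degree-replicate zero    f v = refl
  degree-replicate (suc k) f v = cong (incidence G v f +_) (degree-replicate k f v)

  degree-concatMap : ∀ {A : Set} (h : A → List E) L v →
                     degree G (concatMap h L) v ≡ sum (map (λ a → degree G (h a) v) L)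
  degree-concatMap h []      v = refl
  degree-concatMap h (a ∷ L) v =
    trans (degree-++ (h a) _ v) (cong (degree G (h a) v +_) (degree-concatMap h L v))

  degree-avoiding : ∀ {T} v → All (λ f → incidence G v f ≡ 0) T → degree G T v ≡ 0
  degree-avoiding v []           = refl
  degree-avoiding v (i≡0 ∷ i≡0s) = cong₂ _+_ i≡0 (degree-avoiding v i≡0s)

  incidence≤degree : ∀ {f T} v → f ∈ T → incidence G v f ≤ degree G T v
  incidence≤degree v (here refl)              = m≤m+n _ _
  incidence≤degree {T = g ∷ T} v (there f∈T) = ≤-trans (incidence≤degree v f∈T) (m≤n+m _ (incidence G v g))

  mult-∷ : ∀ f T g → mult G (f ∷ T) g ≡ kronecker _≟E_ g f + mult G T g
  mult-∷ f T g with g ≟E f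
  ... | yes _ = refl
  ... | no  _ = refl

  mult-head : ∀ f T → mult G (f ∷ T) f ≡ suc (mult G T f)
  mult-head f T with f ≟E f
  ... | yes _  = refl
  ... | no f≢f = ⊥-elim (f≢f refl)

  mult-tail : ∀ {f g} T → ¬ g ≡ f → mult G (f ∷ T) g ≡ mult G T g
  mult-tail {f} {g} T g≢f with g ≟E f
  ... | yes g≡f = ⊥-elim (g≢f g≡f)
  ... | no  _   = refl

  ∈⇒mult-pos : ∀ {f T} → f ∈ T → 1 ≤ mult G T f
  ∈⇒mult-pos {f} = filter-some (f ≟E_)

  mult-pos⇒∈ : ∀ {f} T → 1 ≤ mult G T f → f ∈ T
  mult-pos⇒∈ {f} (g ∷ T) pos with f ≟E g
  ... | yes refl = here refl
  ... | no  _    = there (mult-pos⇒∈ T pos)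

  Connects : List E → V → V → Set
  Connects T u w = Σ[ p ∈ Walk G u w ] All (_∈ T) (walkEdges G p)

  module _ {T : List E} where

    connects-refl : ∀ {u} → Connects T u u
    connects-refl = [] , []

    connects-step : ∀ {f u w x} → f ∈ T → Joins G f u w → Connects T w x → Connects T u x
    connects-step f∈T j (p , ps) = step _ j p , f∈T ∷ ps

    connects-trans : ∀ {u w x} → Connects T u w → Connects T w x → Connects T u x
    connects-trans ([] , _)               q = q
    connects-trans (step f j p , f∈ ∷ ps) q = connects-step f∈ j (connects-trans (p , ps) q)

    connects-sym : ∀ {u w} → Connects T u w → Connects T w u
    connects-sym ([] , _)               = connects-refl
    connects-sym (step f j p , f∈ ∷ ps) =
      connects-trans (connects-sym (p , ps)) (connects-step f∈ (Joins-sym j) connects-refl)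

    connects-backwards : (P : V → Set) → (∀ {f u w} → f ∈ T → Joins G f u w → P w → P u) →
                         ∀ {u w} → Connects T u w → P w → P u
    connects-backwards P closed ([] , _)               Pw = Pw
    connects-backwards P closed (step f j p , f∈ ∷ ps) Pw = closed f∈ j (connects-backwards P closed (p , ps) Pw)

    connects⇒degree-pos : ∀ {u w} → Connects T u w → ¬ u ≡ w → 1 ≤ degree G T u
    connects⇒degree-pos ([] , _)              u≢u = ⊥-elim (u≢u refl)
    connects⇒degree-pos (step f j p , f∈ ∷ _) _   = ≤-trans (incidence-Joins-pos j) (incidence≤degree _ f∈)

  connects-mono : ∀ {S T u w} → S ⊆ T → Connects S u w → Connects T u w
  connects-mono S⊆T ([] , _)               = connects-refl
  connects-mono S⊆T (step f j p , f∈ ∷ ps) = connects-step (S⊆T f∈) j (connects-mono S⊆T (p , ps))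

  walk-connects : ∀ {u w y} (p : Walk G u w) → y ∈ walkVertices G p → Connects (walkEdges G p) u y
  walk-connects []           (here refl) = connects-refl
  walk-connects (step f j p) (here refl) = connects-refl
  walk-connects (step f j p) (there y∈p) = connects-step (here refl) j (connects-mono there (walk-connects p y∈p))

  walk-degree-parity : ∀ {u w} (p : Walk G u w) v → 2 ∣ degree G (walkEdges G p) v + (δ v u + δ v w)
  walk-degree-parity {u} [] v = 2∣n+n (δ v u)
  walk-degree-parity {u} {w} (step {w = u'} f j p) v =
    subst (2 ∣_) (sym split) (∣m∣n⇒∣m+n (divides (δ v u) refl) (walk-degree-parity p v))
    where
      rearrange : ∀ a b c D → (a + b + D) + (a + c) ≡ a * 2 + (D + (b + c))
      rearrange = solve-∀
      D = degree G (walkEdges G p) v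
      split : incidence G v f + D + (δ v u + δ v w) ≡ δ v u * 2 + (D + (δ v u' + δ v w))
      split = trans (cong (λ i → i + D + (δ v u + δ v w)) (incidence-Joins j v))
                    (rearrange (δ v u) (δ v u') (δ v w) D)

  closedWalk-degree-even : ∀ {u} (p : Walk G u u) v → 2 ∣ degree G (walkEdges G p) v
  closedWalk-degree-even {u} p v =
    ∣m+n∣m⇒∣n (subst (2 ∣_) (+-comm (degree G (walkEdges G p) v) _) (walk-degree-parity p v)) (2∣n+n (δ v u))

  remove : E → List E → List E
  remove f []      = []
  remove f (g ∷ T) with f ≟E g
  ... | yes _ = T
  ... | no  _ = g ∷ remove f T

  -- A third copy of an edge cancels one of the two already kept, which
  -- changes the degrees by an even amount.
  trim : List E → List E
  trim []      = []
  trim (f ∷ T) with 2 ≤? mult G (trim T) f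
  ... | yes _ = remove f (trim T)
  ... | no  _ = f ∷ trim T
  remove-mult-removed : ∀ f T → 1 ≤ mult G T f → suc (mult G (remove f T) f) ≡ mult G T f
  remove-mult-removed f (g ∷ T) pos with f ≟E g
  ... | yes refl = refl
  ... | no  f≢g rewrite mult-tail (remove f T) f≢g = remove-mult-removed f T pos

  remove-mult-other : ∀ f g T → ¬ g ≡ f → mult G (remove f T) g ≡ mult G T g
  remove-mult-other f g []      _   = refl
  remove-mult-other f g (h ∷ T) g≢f with f ≟E h
  ... | yes refl = sym (mult-tail T g≢f)
  ... | no  _ with g ≟E h
  ...   | yes _ = cong suc (remove-mult-other f g T g≢f)
  ...   | no  _ = remove-mult-other f g T g≢f

  remove-degree : ∀ {f} T v → f ∈ T → incidence G v f + degree G (remove f T) v ≡ degree G T v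
  remove-degree {f} (g ∷ T) v f∈ with f ≟E g
  remove-degree (g ∷ T) v f∈          | yes refl = refl
  remove-degree (g ∷ T) v (here refl) | no f≢f   = ⊥-elim (f≢f refl)
  remove-degree {f} (g ∷ T) v (there f∈T) | no _ = begin
    incidence G v f + (incidence G v g + degree G (remove f T) v)
      ≡⟨ x∙yz≈y∙xz (incidence G v f) (incidence G v g) _ ⟩
    incidence G v g + (incidence G v f + degree G (remove f T) v)
      ≡⟨ cong (incidence G v g +_) (remove-degree T v f∈T) ⟩
    incidence G v g + degree G T v ∎
    where open ≡-Reasoning

  remove-length : ∀ f T → length (remove f T) ≤ length T
  remove-length f []      = z≤n
  remove-length f (g ∷ T) with f ≟E g
  ... | yes _ = n≤1+n _
  ... | no  _ = s≤s (remove-length f T)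

  ∈-remove : ∀ {f g} T → ¬ g ≡ f → g ∈ T → g ∈ remove f T
  ∈-remove {f} (h ∷ T) g≢f g∈ with f ≟E h
  ∈-remove (h ∷ T) g≢f (here refl) | yes refl = ⊥-elim (g≢f refl)
  ∈-remove (h ∷ T) g≢f (there g∈) | yes refl = g∈
  ∈-remove (h ∷ T) g≢f (here refl) | no _ = here refl
  ∈-remove (h ∷ T) g≢f (there g∈) | no _ = there (∈-remove T g≢f g∈)

  trim-mult≤2 : ∀ T g → mult G (trim T) g ≤ 2
  trim-mult≤2 []      g = z≤n
  trim-mult≤2 (f ∷ T) g with 2 ≤? mult G (trim T) f | g ≟E f
  ... | yes two | yes refl = ≤-trans (n≤1+n _)
    (≤-trans (≤-reflexive (remove-mult-removed g (trim T) (≤-trans (s≤s z≤n) two))) (trim-mult≤2 T g))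
  ... | yes _   | no g≢f   = ≤-trans (≤-reflexive (remove-mult-other f g (trim T) g≢f)) (trim-mult≤2 T g)
  ... | no  ¬two | yes refl rewrite mult-head g (trim T) = ≰⇒> ¬two
  ... | no  _    | no g≢f  = ≤-trans (≤-reflexive (mult-tail (trim T) g≢f)) (trim-mult≤2 T g)

  trim-length : ∀ T → length (trim T) ≤ length T
  trim-length []      = z≤n
  trim-length (f ∷ T) with 2 ≤? mult G (trim T) f
  ... | yes _ = ≤-trans (remove-length f (trim T)) (m≤n⇒m≤1+n (trim-length T))
  ... | no  _ = s≤s (trim-length T)

  ⊆-trim : ∀ T → T ⊆ trim T
  ⊆-trim (f ∷ T) g∈ with 2 ≤? mult G (trim T) f
  ... | no  _   = ∷⁺ʳ f (⊆-trim T) g∈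
  ... | yes two = ∈-∷⁺ʳ f∈remove T⊆remove g∈
    where
      f∈remove : f ∈ remove f (trim T)
      f∈remove = mult-pos⇒∈ (remove f (trim T))
        (≤-pred (≤-trans two (≤-reflexive (sym (remove-mult-removed f (trim T) (≤-trans (s≤s z≤n) two))))))
      T⊆remove : T ⊆ remove f (trim T)
      T⊆remove {g} g∈T with g ≟E f
      ... | yes refl = f∈remove
      ... | no  g≢f  = ∈-remove (trim T) g≢f (⊆-trim T g∈T)

  trim-degree-parity : ∀ T v → 2 ∣ degree G T v + degree G (trim T) v
  trim-degree-parity []      v = divides 0 refl
  trim-degree-parity (f ∷ T) v with 2 ≤? mult G (trim T) f
  ... | yes two = subst (2 ∣_) reattach (trim-degree-parity T v)
    where
      reattach : degree G T v + degree G (trim T) v ≡ incidence G v f + degree G T v + degree G (remove f (trim T)) v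
      reattach = trans (cong (degree G T v +_)
                        (sym (remove-degree (trim T) v (mult-pos⇒∈ (trim T) (≤-trans (s≤s z≤n) two)))))
                       (x∙yz≈yx∙z (degree G T v) (incidence G v f) _)
  ... | no  _   = subst (2 ∣_) (double-edge (incidence G v f) (degree G T v) _)
                    (∣m∣n⇒∣m+n (divides (incidence G v f) refl) (trim-degree-parity T v))
    where
      double-edge : ∀ i d d' → i * 2 + (d + d') ≡ i + d + (i + d')
      double-edge = solve-∀

  trim-isTSPTour : ∀ {T} → (∀ v → 2 ∣ degree G T v) → (∀ u w → Connects T u w) → IsTSPTour G (trim T)
  trim-isTSPTour {T} even connected = record
    { atMostTwice = trim-mult≤2 T
    ; evenDegree  = λ v → ∣m+n∣m⇒∣n (trim-degree-parity T v) (even v)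
    ; connected   = λ u w → connects-mono (⊆-trim T) (connected u w)
    }

-- Side s of the triangle joins corners s and s + 1 (see triangleEnds), so the
-- sides at corner r are r and prev r.
prev : Fin 3 → Fin 3
prev 0F = 2F
prev 1F = 0F
prev 2F = 1F

triangleDegree : (Fin 3 → ℕ) → Fin 3 → ℕ
triangleDegree t r = t r + t (prev r)

data Shape : Set where
  cycle : Shape
  path  : (i j : Fin 3) → ¬ i ≡ j → Shape

endpointCount : Shape → Fin 3 → ℕ
endpointCount cycle        l = 0
endpointCount (path i j _) l = δ₃ l i + δ₃ l j

shapeLength : Shape → ℕ
shapeLength cycle        = 8
shapeLength (path _ _ _) = 7

record Reconnection (a t : Fin 3 → ℕ) : Set where
  field
    copies        : Fin 3 → ℕ
    shape         : Shape
    copies-parity : ∀ l → 2 ∣ a l + copies l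
    shape-parity  : ∀ l → 2 ∣ endpointCount shape l + copies l
    kept          : ∀ l → 1 ≤ a l → 1 ≤ triangleDegree t l → 1 ≤ copies l
    anchor        : ∃[ r ] (a r ≡ 0 ⊎ 1 ≤ copies r)
    budget        : Σ₃ copies + shapeLength shape ≤ Σ₃ a + Σ₃ t + 5

odd : ℕ → Bool
odd k = k % 2 ≡ᵇ 1

-- Cutting off a corner that meets no side saves both copies of its cut edge;
-- corner 0 stays attached when no side is used at all, so that some corner
-- anchors the outside of U.
copiesRule : (a t : Fin 3 → ℕ) → Fin 3 → ℕ
copiesRule a t l =
  if odd (a l) then 1
  else if (1 ≤ᵇ triangleDegree t l) ∨ (does (l FinP.≟ 0F) ∧ (Σ₃ t ≡ᵇ 0)) then a l
  else 0

shapeFor : Bool → Bool → Bool → Shape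
shapeFor true  true  false = path 0F 1F (λ ())
shapeFor true  false true  = path 0F 2F (λ ())
shapeFor false true  true  = path 1F 2F (λ ())
shapeFor _     _     _     = cycle

shapeRule : (Fin 3 → ℕ) → Shape
shapeRule a = shapeFor (odd (a 0F)) (odd (a 1F)) (odd (a 2F))

All₃ Any₃ : (Fin 3 → Set) → Set
All₃ P = P 0F × P 1F × P 2F
Any₃ P = P 0F ⊎ P 1F ⊎ P 2F

all₃? : {P : Fin 3 → Set} → Decidable P → Dec (All₃ P)
all₃? P? = P? 0F ×-dec P? 1F ×-dec P? 2F

any₃? : {P : Fin 3 → Set} → Decidable P → Dec (Any₃ P)
any₃? P? = P? 0F ⊎-dec P? 1F ⊎-dec P? 2F

all₃ : {P : Fin 3 → Set} → All₃ P → ∀ l → P l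
all₃ (p , _ , _) 0F = p
all₃ (_ , p , _) 1F = p
all₃ (_ , _ , p) 2F = p

any₃ : {P : Fin 3 → Set} → Any₃ P → ∃[ l ] P l
any₃ (inj₁ p)        = 0F , p
any₃ (inj₂ (inj₁ p)) = 1F , p
any₃ (inj₂ (inj₂ p)) = 2F , p

-- Quantifiers over corners are unfolded, so that RuleWorks a t depends on a
-- and t only through their values at 0F, 1F, 2F and agrees definitionally
-- with the instance checked in ruleWorks-table.
RuleWorks : (a t : Fin 3 → ℕ) → Set
RuleWorks a t =
  All₃ (λ r → 2 ∣ a r + triangleDegree t r) →
  All₃ (λ r → 1 ≤ a r + triangleDegree t r) →
  All₃ (λ l → 2 ∣ a l + c l) × All₃ (λ l → 2 ∣ endpointCount s l + c l) ×
  All₃ (λ l → 1 ≤ a l → 1 ≤ triangleDegree t l → 1 ≤ c l) ×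
  Any₃ (λ r → a r ≡ 0 ⊎ 1 ≤ c r) ×
  Σ₃ c + shapeLength s ≤ Σ₃ a + Σ₃ t + 5
  where
    c = copiesRule a t
    s = shapeRule a

ruleWorks? : ∀ a t → Dec (RuleWorks a t)
ruleWorks? a t =
  all₃? (λ r → 2 ∣? a r + triangleDegree t r) →-dec
  all₃? (λ r → 1 ≤? a r + triangleDegree t r) →-dec
  all₃? (λ l → 2 ∣? a l + c l) ×-dec all₃? (λ l → 2 ∣? endpointCount s l + c l) ×-dec
  all₃? (λ l → 1 ≤? a l →-dec 1 ≤? triangleDegree t l →-dec 1 ≤? c l) ×-dec
  any₃? (λ r → a r ≟ 0 ⊎-dec 1 ≤? c r) ×-dec
  Σ₃ c + shapeLength s ≤? Σ₃ a + Σ₃ t + 5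
  where
    c = copiesRule a t
    s = shapeRule a

-- Opaque, since unfolding the proof would rerun the check of all 3⁶ cases.
opaque
  ruleWorks-table : ∀ {a₀} → a₀ < 3 → ∀ {a₁} → a₁ < 3 → ∀ {a₂} → a₂ < 3 →
                    ∀ {t₀} → t₀ < 3 → ∀ {t₁} → t₁ < 3 → ∀ {t₂} → t₂ < 3 →
                    RuleWorks (a₀ Vector.∷ a₁ Vector.∷ a₂ Vector.∷ Vector.[]) (t₀ Vector.∷ t₁ Vector.∷ t₂ Vector.∷ Vector.[])
  ruleWorks-table = toWitness {a? = allUpTo? (λ a₀ → allUpTo? (λ a₁ → allUpTo? (λ a₂ →
    allUpTo? (λ t₀ → allUpTo? (λ t₁ → allUpTo? (λ t₂ →
      ruleWorks? (a₀ Vector.∷ a₁ Vector.∷ a₂ Vector.∷ Vector.[]) (t₀ Vector.∷ t₁ Vector.∷ t₂ Vector.∷ Vector.[])) 3) 3) 3) 3) 3) 3} _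

reconnect : (a t : Fin 3 → ℕ) → (∀ l → a l ≤ 2) → (∀ s → t s ≤ 2) →
            (∀ r → 2 ∣ a r + triangleDegree t r) → (∀ r → 1 ≤ a r + triangleDegree t r) →
            Reconnection a t
reconnect a t a≤2 t≤2 even positive
  with ruleWorks-table (s≤s (a≤2 0F)) (s≤s (a≤2 1F)) (s≤s (a≤2 2F)) (s≤s (t≤2 0F)) (s≤s (t≤2 1F)) (s≤s (t≤2 2F))
         (even 0F , even 1F , even 2F) (positive 0F , positive 1F , positive 2F)
... | copies-parity , shape-parity , kept , anchor , budget = record
  { copies        = copiesRule a t
  ; shape         = shapeRule a
  ; copies-parity = all₃ copies-parity
  ; shape-parity  = all₃ shape-parity
  ; kept          = all₃ kept
  ; anchor        = any₃ anchor
  ; budget        = budget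
  }

-- The graph H, in which G[U] is replaced by a triangle

pattern corner r = inj₂ r
pattern cut l    = inj₂ (inj₁ l)
pattern side s   = inj₂ (inj₂ s)

module Contraction {n m : ℕ} (ends : Fin m → Fin n × Fin n) (U : Subset n)
                   (x : Fin 3 → Fin n) (xout : ∀ i → OutU U (x i)) where

  private
    G = finGraph n m ends
    H = contract ends U x xout

  cutMult sideMult : List (Graph.E H) → Fin 3 → ℕ
  cutMult  T l = mult H T (cut l)
  sideMult T s = mult H T (side s)

  outerEdges : List (Graph.E H) → List (Fin m)
  outerEdges []                 = []
  outerEdges (inj₁ (g , _) ∷ T) = g ∷ outerEdges T
  outerEdges (inj₂ _ ∷ T)       = outerEdges T

  ∈-outerEdges : ∀ {g q} T → inj₁ (g , q) ∈ T → g ∈ outerEdges T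
  ∈-outerEdges (_ ∷ T)      (here refl) = here refl
  ∈-outerEdges (inj₁ _ ∷ T) (there g∈) = there (∈-outerEdges T g∈)
  ∈-outerEdges (inj₂ _ ∷ T) (there g∈) = ∈-outerEdges T g∈

  outerEdges-outside : ∀ T → All (OutsideEdge ends U) (outerEdges T)
  outerEdges-outside []                 = []
  outerEdges-outside (inj₁ (_ , q) ∷ T) = q ∷ outerEdges-outside T
  outerEdges-outside (inj₂ _ ∷ T)       = outerEdges-outside T

  side-touches : ∀ s (t : Fin 3 → ℕ) → 1 ≤ t s →
                 1 ≤ triangleDegree t (proj₁ (triangleEnds ends U s)) × 1 ≤ triangleDegree t (proj₂ (triangleEnds ends U s))
  side-touches 0F t t≥1 = ≤-trans t≥1 (m≤m+n _ _) , ≤-trans t≥1 (m≤n+m _ _)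
  side-touches 1F t t≥1 = ≤-trans t≥1 (m≤m+n _ _) , ≤-trans t≥1 (m≤n+m _ _)
  side-touches 2F t t≥1 = ≤-trans t≥1 (m≤m+n _ _) , ≤-trans t≥1 (m≤n+m _ _)

  corner-sides : ∀ r s → δ₃ r (proj₁ (triangleEnds ends U s)) + δ₃ r (proj₂ (triangleEnds ends U s)) ≡ δ₃ r s + δ₃ (prev r) s
  corner-sides 0F 0F = refl
  corner-sides 0F 1F = refl
  corner-sides 0F 2F = refl
  corner-sides 1F 0F = refl
  corner-sides 1F 1F = refl
  corner-sides 1F 2F = refl
  corner-sides 2F 0F = refl
  corner-sides 2F 1F = refl
  corner-sides 2F 2F = refl

  degree-corner : ∀ T r → degree H T (corner r) ≡ cutMult T r + triangleDegree (sideMult T) r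
  degree-corner []           r = refl
  degree-corner (inj₁ _ ∷ T) r = degree-corner T r
  degree-corner (cut l ∷ T)  r = begin
    incidence H (corner r) (cut l) + degree H T (corner r)
      ≡⟨ cong₂ _+_ (incidence-δ H (corner r) (cut l)) (degree-corner T r) ⟩
    δ₃ r l + (cutMult T r + triangleDegree (sideMult T) r)
      ≡⟨ +-assoc (δ₃ r l) _ _ ⟨
    δ₃ r l + cutMult T r + triangleDegree (sideMult T) r
      ≡⟨ cong (_+ triangleDegree (sideMult T) r) (mult-∷ H (cut l) T (cut r)) ⟨
    cutMult (cut l ∷ T) r + triangleDegree (sideMult (cut l ∷ T)) r ∎
    where open ≡-Reasoning
  degree-corner (side s ∷ T) r = begin
    incidence H (corner r) (side s) + degree H T (corner r)
      ≡⟨ cong₂ _+_ (trans (incidence-δ H (corner r) (side s)) (corner-sides r s)) (degree-corner T r) ⟩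
    δ₃ r s + δ₃ (prev r) s + (cutMult T r + (sideMult T r + sideMult T (prev r)))
      ≡⟨ shuffle (δ₃ r s) (δ₃ (prev r) s) (cutMult T r) (sideMult T r) (sideMult T (prev r)) ⟩
    cutMult T r + ((δ₃ r s + sideMult T r) + (δ₃ (prev r) s + sideMult T (prev r)))
      ≡⟨ cong (cutMult T r +_) (cong₂ _+_ (mult-∷ H (side s) T (side r)) (mult-∷ H (side s) T (side (prev r)))) ⟨
    cutMult (side s ∷ T) r + triangleDegree (sideMult (side s ∷ T)) r ∎
    where
      open ≡-Reasoning
      shuffle : ∀ a b c d e → a + b + (c + (d + e)) ≡ c + ((a + d) + (b + e))
      shuffle = solve-∀

  δ-outer : ∀ {w u} (pw : OutU U w) (pu : OutU U u) → δ H (inj₁ (w , pw)) (inj₁ (u , pu)) ≡ δ G w u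
  δ-outer {w} {u} _ _ with w FinP.≟ u
  ... | yes refl = refl
  ... | no  _    = refl

  incidence-outer-outer : ∀ {w} (pw : OutU U w) g q₁ q₂ → incidence H (inj₁ (w , pw)) (inj₁ (g , q₁ , q₂)) ≡ incidence G w g
  incidence-outer-outer {w} pw g q₁ q₂ =
    trans (incidence-δ H (inj₁ (w , pw)) (inj₁ (g , q₁ , q₂)))
          (trans (cong₂ _+_ (δ-outer pw q₁) (δ-outer pw q₂)) (sym (incidence-δ G w g)))

  incidence-outer-cut : ∀ {w} (pw : OutU U w) l → incidence H (inj₁ (w , pw)) (cut l) ≡ δ G w (x l)
  incidence-outer-cut {w} pw l = trans (incidence-δ H (inj₁ (w , pw)) (cut l)) (trans (+-identityʳ _) (δ-outer pw (xout l)))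

  Σ₃-cutMult-∷ : ∀ l T (d : Fin 3 → ℕ) → Σ₃ (λ l' → cutMult (cut l ∷ T) l' * d l') ≡ d l + Σ₃ (λ l' → cutMult T l' * d l')
  Σ₃-cutMult-∷ l T d = begin
    Σ₃ (λ l' → cutMult (cut l ∷ T) l' * d l')
      ≡⟨ Σ₃-cong (λ l' → trans (cong (_* d l') (mult-∷ H (cut l) T (cut l'))) (*-distribʳ-+ (d l') (δ₃ l' l) _)) ⟩
    Σ₃ (λ l' → δ₃ l' l * d l' + cutMult T l' * d l')
      ≡⟨ sum-map-+ (λ l' → δ₃ l' l * d l') (λ l' → cutMult T l' * d l') (allFin 3) ⟩
    Σ₃ (λ l' → δ₃ l' l * d l') + Σ₃ (λ l' → cutMult T l' * d l')
      ≡⟨ cong (_+ Σ₃ (λ l' → cutMult T l' * d l')) (Σ₃-select l d) ⟩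
    d l + Σ₃ (λ l' → cutMult T l' * d l') ∎
    where open ≡-Reasoning

  degree-outer : ∀ T {w} (pw : OutU U w) →
                 degree H T (inj₁ (w , pw)) ≡ degree G (outerEdges T) w + Σ₃ (λ l → cutMult T l * δ G w (x l))
  degree-outer []                           pw = refl
  degree-outer (inj₁ (g , q₁ , q₂) ∷ T) {w} pw =
    trans (cong₂ _+_ (incidence-outer-outer pw g q₁ q₂) (degree-outer T pw))
          (sym (+-assoc (incidence G w g) (degree G (outerEdges T) w) _))
  degree-outer (cut l ∷ T)              {w} pw = begin
    incidence H (inj₁ (w , pw)) (cut l) + degree H T (inj₁ (w , pw))
      ≡⟨ cong₂ _+_ (incidence-outer-cut pw l) (degree-outer T pw) ⟩
    δ G w (x l) + (degree G (outerEdges T) w + Σ₃ (λ l' → cutMult T l' * δ G w (x l')))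
      ≡⟨ x∙yz≈y∙xz (δ G w (x l)) (degree G (outerEdges T) w) _ ⟩
    degree G (outerEdges T) w + (δ G w (x l) + Σ₃ (λ l' → cutMult T l' * δ G w (x l')))
      ≡⟨ cong (degree G (outerEdges T) w +_) (Σ₃-cutMult-∷ l T (λ l' → δ G w (x l'))) ⟨
    degree G (outerEdges T) w + Σ₃ (λ l' → cutMult (cut l ∷ T) l' * δ G w (x l')) ∎
    where open ≡-Reasoning
  degree-outer (side s ∷ T)                 pw = degree-outer T pw

  length-split : ∀ T → length T ≡ length (outerEdges T) + Σ₃ (cutMult T) + Σ₃ (sideMult T)
  length-split []           = refl
  length-split (inj₁ _ ∷ T) = cong suc (length-split T)
  length-split (cut l ∷ T)  = begin
    suc (length T)
      ≡⟨ cong suc (length-split T) ⟩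
    suc (length (outerEdges T) + Σ₃ (cutMult T) + Σ₃ (sideMult T))
      ≡⟨ cong (_+ Σ₃ (sideMult T)) (+-suc (length (outerEdges T)) _) ⟨
    length (outerEdges T) + suc (Σ₃ (cutMult T)) + Σ₃ (sideMult T)
      ≡⟨ cong (λ c → length (outerEdges T) + c + Σ₃ (sideMult T)) (Σ₃-bump l (mult-∷ H (cut l) T ∘ cut)) ⟨
    length (outerEdges T) + Σ₃ (cutMult (cut l ∷ T)) + Σ₃ (sideMult T) ∎
    where open ≡-Reasoning
  length-split (side s ∷ T) = begin
    suc (length T)
      ≡⟨ cong suc (length-split T) ⟩
    suc (length (outerEdges T) + Σ₃ (cutMult T) + Σ₃ (sideMult T))
      ≡⟨ +-suc _ _ ⟨
    length (outerEdges T) + Σ₃ (cutMult T) + suc (Σ₃ (sideMult T))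
      ≡⟨ cong (length (outerEdges T) + Σ₃ (cutMult T) +_) (Σ₃-bump s (mult-∷ H (side s) T ∘ side)) ⟨
    length (outerEdges T) + Σ₃ (cutMult T) + Σ₃ (sideMult (side s ∷ T)) ∎
    where open ≡-Reasoning

module Inside {n m : ℕ} (ends : Fin m → Fin n × Fin n) (U : Subset n) where

  private
    G  = finGraph n m ends
    Gᵤ = induced ends U

  inside-or-outside : ∀ w → InU U w ⊎ OutU U w
  inside-or-outside w with lookup U w
  ... | true  = inj₁ refl
  ... | false = inj₂ refl

  inside≢outside : ∀ {a b} → InU U a → OutU U b → ¬ a ≡ b
  inside≢outside a∈ b∉ refl with trans (sym a∈) b∉
  ... | ()

  δ-inside-outside : ∀ {a b} → InU U a → OutU U b → δ G a b ≡ 0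
  δ-inside-outside {a} {b} a∈ b∉ with a FinP.≟ b
  ... | yes a≡b = ⊥-elim (inside≢outside a∈ b∉ a≡b)
  ... | no  _   = refl

  δ-outside-inside : ∀ {a b} → OutU U a → InU U b → δ G a b ≡ 0
  δ-outside-inside {a} {b} a∉ b∈ with a FinP.≟ b
  ... | yes a≡b = ⊥-elim (inside≢outside b∈ a∉ (sym a≡b))
  ... | no  _   = refl

  incidence-outside-at-inside : ∀ {f w} → OutsideEdge ends U f → InU U w → incidence G w f ≡ 0
  incidence-outside-at-inside {f} {w} (q₁ , q₂) w∈ =
    trans (incidence-δ G w f) (cong₂ _+_ (δ-inside-outside w∈ q₁) (δ-inside-outside w∈ q₂))

  incidence-inside-at-outside : ∀ {f w} → InsideEdge ends U f → OutU U w → incidence G w f ≡ 0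
  incidence-inside-at-outside {f} {w} (q₁ , q₂) w∉ =
    trans (incidence-δ G w f) (cong₂ _+_ (δ-outside-inside w∉ q₁) (δ-outside-inside w∉ q₂))

  lift-Joins : ∀ {g a b} → Joins Gᵤ g a b → Joins G (proj₁ g) (proj₁ a) (proj₁ b)
  lift-Joins (inj₁ refl) = inj₁ refl
  lift-Joins (inj₂ refl) = inj₂ refl

  liftWalk : ∀ {a b} → Walk Gᵤ a b → Walk G (proj₁ a) (proj₁ b)
  liftWalk []           = []
  liftWalk (step g j p) = step (proj₁ g) (lift-Joins j) (liftWalk p)

  liftWalk-length : ∀ {a b} (p : Walk Gᵤ a b) → walkLength G (liftWalk p) ≡ walkLength Gᵤ p
  liftWalk-length []           = refl
  liftWalk-length (step g j p) = cong suc (liftWalk-length p)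

  ∈-liftWalk : ∀ {a b y} (p : Walk Gᵤ a b) → y ∈ walkVertices Gᵤ p → proj₁ y ∈ walkVertices G (liftWalk p)
  ∈-liftWalk []           (here refl) = here refl
  ∈-liftWalk (step g j p) (here refl) = here refl
  ∈-liftWalk (step g j p) (there y∈) = there (∈-liftWalk p y∈)

  liftWalk-inside : ∀ {a b} (p : Walk Gᵤ a b) → All (InsideEdge ends U) (walkEdges G (liftWalk p))
  liftWalk-inside []                 = []
  liftWalk-inside (step (g , q) j p) = q ∷ liftWalk-inside p

  module _ (v : Fin 3 → Fin n) (vin : ∀ i → InU U (v i)) where

    record ShapedWalk (s : Shape) : Set where
      field
        {start finish} : Graph.V Gᵤ
        walk     : Walk Gᵤ start finish
        short    : walkLength Gᵤ walk ≤ shapeLength s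
        spanning : Spanning Gᵤ walk
        parity   : ∀ w → 2 ∣ degree G (walkEdges G (liftWalk walk)) w + Σ₃ (λ l → endpointCount s l * δ G w (v l))

    shapedWalk : (Σ[ u ∈ Graph.V Gᵤ ] Σ[ C ∈ Walk Gᵤ u u ] (walkLength Gᵤ C ≤ 8 × Spanning Gᵤ C)) →
                 (∀ i j → ¬ i ≡ j →
                    Σ[ P ∈ Walk Gᵤ (v i , vin i) (v j , vin j) ] (walkLength Gᵤ P ≤ 7 × Spanning Gᵤ P)) →
                 ∀ s → ShapedWalk s
    shapedWalk (u , C , short , spanning) _ cycle = record
      { walk = C ; short = short ; spanning = spanning ; parity = parity }
      where
        parity : ∀ w → 2 ∣ degree G (walkEdges G (liftWalk C)) w + 0
        parity w = subst (2 ∣_) (sym (+-identityʳ _)) (closedWalk-degree-even G (liftWalk C) w)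
    shapedWalk _ paths (path i j i≢j) with paths i j i≢j
    ... | P , short , spanning = record
      { walk = P ; short = short ; spanning = spanning
      ; parity = λ w → subst (2 ∣_) (cong (degree G (walkEdges G (liftWalk P)) w +_)
                                           (sym (Σ₃-select₂ i j (λ l → δ G w (v l)))))
                                    (walk-degree-parity G (liftWalk P) w) }

-- From a tour of H to a tour of G

module Lift {n m : ℕ} (ends : Fin m → Fin n × Fin n) (U : Subset n)
  (e : Fin 3 → Fin m) (v x : Fin 3 → Fin n)
  (joins : ∀ i → Joins (finGraph n m ends) (e i) (v i) (x i))
  (vin : ∀ i → InU U (v i)) (xout : ∀ i → OutU U (x i))
  (closed : Σ[ u ∈ Graph.V (induced ends U) ] Σ[ C ∈ Walk (induced ends U) u u ]
              (walkLength (induced ends U) C ≤ 8 × Spanning (induced ends U) C))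
  (paths : ∀ i j → ¬ i ≡ j →
             Σ[ P ∈ Walk (induced ends U) (v i , vin i) (v j , vin j) ]
               (walkLength (induced ends U) P ≤ 7 × Spanning (induced ends U) P))
  (T' : List (Graph.E (contract ends U x xout))) (tour : IsTSPTour (contract ends U x xout) T')
  where

  private
    G  = finGraph n m ends
    Gᵤ = induced ends U
    H  = contract ends U x xout

  open Inside ends U
  open Contraction ends U x xout
  open IsTSPTour tour

  a t : Fin 3 → ℕ
  a = cutMult T'
  t = sideMult T'

  plan : Reconnection a t
  plan = reconnect a t (λ l → atMostTwice (cut l)) (λ s → atMostTwice (side s))
    (λ r → subst (2 ∣_) (degree-corner T' r) (evenDegree (corner r)))
    (λ r → subst (1 ≤_) (degree-corner T' r)
             (connects⇒degree-pos H (connected (corner r) (inj₁ (x 0F , xout 0F))) λ ()))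

  open Reconnection plan
  open ShapedWalk (shapedWalk v vin closed paths shape)

  cutCopies : List (Fin m)
  cutCopies = concatMap (λ l → replicate (copies l) (e l)) (allFin 3)

  T₀ : List (Fin m)
  T₀ = outerEdges T' ++ cutCopies ++ walkEdges G (liftWalk walk)

  degree-T₀ : ∀ w → degree G T₀ w ≡
    degree G (outerEdges T') w + (Σ₃ (λ l → copies l * (δ G w (v l) + δ G w (x l))) + degree G (walkEdges G (liftWalk walk)) w)
  degree-T₀ w = trans (degree-++ G (outerEdges T') _ w) (cong (degree G (outerEdges T') w +_)
    (trans (degree-++ G cutCopies _ w) (cong (_+ degree G (walkEdges G (liftWalk walk)) w) degree-cutCopies)))
    where
      degree-cutCopies : degree G cutCopies w ≡ Σ₃ (λ l → copies l * (δ G w (v l) + δ G w (x l)))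
      degree-cutCopies = trans (degree-concatMap G (λ l → replicate (copies l) (e l)) (allFin 3) w)
        (Σ₃-cong (λ l → trans (degree-replicate G (copies l) (e l) w) (cong (copies l *_) (incidence-Joins G (joins l) w))))

  degree-T₀-inside : ∀ {w} → InU U w →
    degree G T₀ w ≡ degree G (walkEdges G (liftWalk walk)) w + Σ₃ (λ l → copies l * δ G w (v l))
  degree-T₀-inside {w} w∈ = begin
    degree G T₀ w
      ≡⟨ degree-T₀ w ⟩
    degree G (outerEdges T') w + (Σ₃ (λ l → copies l * (δ G w (v l) + δ G w (x l))) + D)
      ≡⟨ cong₂ (λ o c → o + (c + D)) outer≡0 (Σ₃-cong (λ l → cong (λ d → copies l * d) (x-far l))) ⟩
    Σ₃ (λ l → copies l * δ G w (v l)) + D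
      ≡⟨ +-comm _ D ⟩
    D + Σ₃ (λ l → copies l * δ G w (v l)) ∎
    where
      open ≡-Reasoning
      D = degree G (walkEdges G (liftWalk walk)) w
      outer≡0 : degree G (outerEdges T') w ≡ 0
      outer≡0 = degree-avoiding G w (All.map (λ q → incidence-outside-at-inside {w = w} q w∈) (outerEdges-outside T'))
      x-far : ∀ l → δ G w (v l) + δ G w (x l) ≡ δ G w (v l)
      x-far l = trans (cong (δ G w (v l) +_) (δ-inside-outside w∈ (xout l))) (+-identityʳ _)

  degree-T₀-outside : ∀ {w} → OutU U w →
    degree G T₀ w ≡ degree G (outerEdges T') w + Σ₃ (λ l → copies l * δ G w (x l))
  degree-T₀-outside {w} w∉ = begin
    degree G T₀ w
      ≡⟨ degree-T₀ w ⟩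
    O + (Σ₃ (λ l → copies l * (δ G w (v l) + δ G w (x l))) + degree G (walkEdges G (liftWalk walk)) w)
      ≡⟨ cong₂ (λ c d → O + (c + d)) (Σ₃-cong (λ l → cong (λ d → copies l * d) (v-far l))) walk≡0 ⟩
    O + (Σ₃ (λ l → copies l * δ G w (x l)) + 0)
      ≡⟨ cong (O +_) (+-identityʳ _) ⟩
    O + Σ₃ (λ l → copies l * δ G w (x l)) ∎
    where
      open ≡-Reasoning
      O = degree G (outerEdges T') w
      walk≡0 : degree G (walkEdges G (liftWalk walk)) w ≡ 0
      walk≡0 = degree-avoiding G w (All.map (λ q → incidence-inside-at-outside {w = w} q w∉) (liftWalk-inside walk))
      v-far : ∀ l → δ G w (v l) + δ G w (x l) ≡ δ G w (x l)
      v-far l = cong (_+ δ G w (x l)) (δ-outside-inside w∉ (vin l))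

  T₀-even : ∀ w → 2 ∣ degree G T₀ w
  T₀-even w with inside-or-outside w
  ... | inj₁ w∈ = subst (2 ∣_) (sym (degree-T₀-inside w∈))
                    (Σ₃-parity (degree G (walkEdges G (liftWalk walk)) w) {endpointCount shape} {copies}
                               (λ l → δ G w (v l)) shape-parity (parity w))
  ... | inj₂ w∉ = subst (2 ∣_) (sym (degree-T₀-outside w∉))
                    (Σ₃-parity (degree G (outerEdges T') w) {a} {copies} (λ l → δ G w (x l)) copies-parity
                      (subst (2 ∣_) (degree-outer T' w∉) (evenDegree (inj₁ (w , w∉)))))

  walk⊆T₀ : walkEdges G (liftWalk walk) ⊆ T₀
  walk⊆T₀ = ⊆-trans (xs⊆ys++xs _ cutCopies) (xs⊆ys++xs _ (outerEdges T'))

  cut∈T₀ : ∀ l → 1 ≤ copies l → e l ∈ T₀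
  cut∈T₀ l copied = xs⊆ys++xs _ (outerEdges T') (xs⊆xs++ys cutCopies _
    (∈-concatMap⁺ (λ l → replicate (copies l) (e l)) (Any.map (λ { refl → ∈-replicate (e l) copied }) (∈-allFin l))))

  outer∈T₀ : ∀ {g q} → inj₁ (g , q) ∈ T' → g ∈ T₀
  outer∈T₀ g∈ = xs⊆xs++ys (outerEdges T') _ (∈-outerEdges T' g∈)

  Reaches : Fin n → Set
  Reaches u = Connects G T₀ u (proj₁ start)

  inside-reaches : ∀ {y} → InU U y → Reaches y
  inside-reaches {y} y∈ =
    connects-sym G (connects-mono G walk⊆T₀ (walk-connects G (liftWalk walk) (∈-liftWalk walk (spanning (y , y∈)))))

  cut-reaches : ∀ l → 1 ≤ copies l → Reaches (x l)
  cut-reaches l copied = connects-step G (cut∈T₀ l copied) (Joins-sym G (joins l)) (inside-reaches (vin l))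

  Anchored : Graph.V H → Set
  Anchored (inj₁ (o , _)) = Reaches o
  Anchored (corner r)     = cut r ∈ T' → Reaches (x r)

  corner-anchored : ∀ {r} → 1 ≤ triangleDegree t r → Anchored (corner r)
  corner-anchored {r} touched r∈ = cut-reaches r (kept r (∈⇒mult-pos H r∈) touched)

  -- A corner whose cut edge was dropped meets no side of the triangle (kept),
  -- so a T'-walk can enter and leave it only through that cut edge.
  anchored-closed : ∀ {f u w} → f ∈ T' → Joins H f u w → Anchored w → Anchored u
  anchored-closed {inj₁ _} g∈ (inj₁ refl) = connects-step G (outer∈T₀ g∈) (inj₁ refl)
  anchored-closed {inj₁ _} g∈ (inj₂ refl) = connects-step G (outer∈T₀ g∈) (inj₂ refl)
  anchored-closed {cut l}  l∈ (inj₁ refl) anchored = anchored l∈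
  anchored-closed {cut l}  l∈ (inj₂ refl) reaches  = λ _ → reaches
  anchored-closed {side s} s∈ (inj₁ refl) _ = corner-anchored (proj₁ (side-touches s t (∈⇒mult-pos H s∈)))
  anchored-closed {side s} s∈ (inj₂ refl) _ = corner-anchored (proj₂ (side-touches s t (∈⇒mult-pos H s∈)))

  anchor-anchored : Anchored (corner (proj₁ anchor))
  anchor-anchored with anchor
  ... | r , inj₁ a≡0    = λ r∈ → ⊥-elim (1+n≰n (≤-trans (∈⇒mult-pos H r∈) (≤-reflexive a≡0)))
  ... | r , inj₂ copied = λ _ → cut-reaches r copied

  reaches : ∀ u → Reaches u
  reaches u with inside-or-outside u
  ... | inj₁ u∈ = inside-reaches u∈
  ... | inj₂ u∉ = connects-backwards H Anchored anchored-closed (connected (inj₁ (u , u∉)) (corner (proj₁ anchor))) anchor-anchored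

  T₀-connected : ∀ u w → Connects G T₀ u w
  T₀-connected u w = connects-trans G (reaches u) (connects-sym G (reaches w))

  T₀-short : length T₀ ≤ length T' + 5
  T₀-short = begin
    length T₀
      ≡⟨ length-T₀ ⟩
    O + (Σ₃ copies + walkLength Gᵤ walk)
      ≤⟨ +-monoʳ-≤ O (+-monoʳ-≤ (Σ₃ copies) short) ⟩
    O + (Σ₃ copies + shapeLength shape)
      ≤⟨ +-monoʳ-≤ O budget ⟩
    O + (Σ₃ a + Σ₃ t + 5)
      ≡⟨ regroup O (Σ₃ a) (Σ₃ t) ⟩
    O + Σ₃ a + Σ₃ t + 5
      ≡⟨ cong (_+ 5) (length-split T') ⟨
    length T' + 5 ∎
    where
      open ≤-Reasoning
      O = length (outerEdges T')
      regroup : ∀ o c s → o + (c + s + 5) ≡ o + c + s + 5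
      regroup = solve-∀
      length-T₀ : length T₀ ≡ O + (Σ₃ copies + walkLength Gᵤ walk)
      length-T₀ = trans (length-++ (outerEdges T')) (cong (O +_) (trans (length-++ cutCopies)
        (cong₂ _+_ (trans (length-concatMap (λ l → replicate (copies l) (e l)) (allFin 3))
                          (Σ₃-cong (λ l → length-replicate (copies l) {e l})))
                   (liftWalk-length walk))))

mainTheorem12 : (n m : ℕ) (ends : Fin m → Fin n × Fin n) (U : Subset n) →
    ∣ U ∣ ≡ 7 →
    (e : Fin 3 → Fin m) → (∀ i j → e i ≡ e j → i ≡ j) →
    (v x : Fin 3 → Fin n) →
    (∀ i → Joins (finGraph n m ends) (e i) (v i) (x i)) →
    (vin : ∀ i → InU U (v i)) → (xout : ∀ i → OutU U (x i)) →
    (∀ f → InCut ends U f → ∃[ i ] (f ≡ e i)) →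
    (Σ[ u ∈ Graph.V (induced ends U) ]
       Σ[ C ∈ Walk (induced ends U) u u ]
         (walkLength (induced ends U) C ≤ 8 × Spanning (induced ends U) C)) →
    (∀ i j → i ≢ j →
       Σ[ P ∈ Walk (induced ends U) (v i , vin i) (v j , vin j) ]
         (walkLength (induced ends U) P ≤ 7 × Spanning (induced ends U) P)) →
    (T' : List (Graph.E (contract ends U x xout))) →
    IsTSPTour (contract ends U x xout) T' →
    Σ[ T ∈ List (Fin m) ]
      (IsTSPTour (finGraph n m ends) T × length T ≤ length T' + 5)
mainTheorem12 n m ends U _ e _ v x joins vin xout _ closed paths T' tour =
  trim G T₀ , trim-isTSPTour G T₀-even T₀-connected , ≤-trans (trim-length G T₀) T₀-short
  where
    G = finGraph n m ends
    open Lift ends U e v x joins vin xout closed paths T' tour
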